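{- Let $G$ be a complete $q$-partite graph of order $n$ with $q \geq 2$. Then $\mathrm{MOF}(G) \geq n - q + 1$. Moreover, equality $\mathrm{MOF}(G) = n-q+1$ holds whenever $q=2$, and whenever $q=3$ and each of the three parts has at least two vertices.
   Context: A complete $q$-partite graph has its vertex set partitioned into $q\ge 2$ nonempty independent sets (parts), with every edge between vertices in different parts present. An orientation of $G$ assigns to each edge $\{u,v\}$ exactly one of the arcs $(u,v)$ or $(v,u)$; if $(u,v)$ is an arc, $v$ is an out-neighbor of $u$. Oriented forcing: given an orientation $D$ and a set $S$ of initially colored vertices, any colored vertex having at most $1$ non-colored out-neighbor forces that out-neighbor to become colored; this rule is applied iteratively as long as possible. $S$ is a forcing set of $D$ if at the end every vertex is colored. $F(D)$ is the minimum size of a forcing set of $D$, and $\mathrm{MOF}(G)$ is the maximum of $F(D)$ over all orientations $D$ of $G$. -}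

module Defs where

open import Data.Nat using (ℕ; suc; _+_; _∸_; _≤_)
open import Data.Fin using (Fin)
open import Data.Fin.Subset using (Subset; _∈_; ∣_∣)
open import Data.Bool using (Bool; true; false)
open import Data.Product using (Σ; _×_; ∃; ∃-syntax)
open import Data.Sum using (_⊎_)
open import Relation.Binary.PropositionalEquality using (_≡_; _≢_)
open import Relation.Nullary using (¬_)

-- A complete q-partite graph on vertex set Fin n is given by a part map
-- part : Fin n → Fin q which is surjective (all q parts nonempty).
record CompleteMultipartite (n q : ℕ) : Set where
  field
    part       : Fin n → Fin q
    surjective : (i : Fin q) → ∃[ v ] part v ≡ i

open CompleteMultipartite public

Adjacent : ∀ {n q} → CompleteMultipartite n q → Fin n → Fin n → Set
Adjacent G u v = part G u ≢ part G v

record Orientation {n q : ℕ} (G : CompleteMultipartite n q) : Set where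
  field
    arc        : Fin n → Fin n → Bool
    arc-edge   : ∀ u v → arc u v ≡ true → Adjacent G u v
    arc-total  : ∀ u v → Adjacent G u v → arc u v ≡ true ⊎ arc v u ≡ true
    arc-asym   : ∀ u v → arc u v ≡ true → arc v u ≡ false

open Orientation public

Out : ∀ {n q} {G : CompleteMultipartite n q} → Orientation G → Fin n → Fin n → Set
Out D u v = arc D u v ≡ true

data Colored {n q} {G : CompleteMultipartite n q} (D : Orientation G)
             (S : Subset n) : Fin n → Set where
  initial : ∀ {v} → v ∈ S → Colored D S v
  force   : ∀ {u v} → Colored D S u → Out D u v →
            (∀ w → Out D u w → w ≢ v → Colored D S w) →
            Colored D S v

IsForcingSet : ∀ {n q} {G : CompleteMultipartite n q} → Orientation G → Subset n → Set
IsForcingSet D S = ∀ v → Colored D S v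

F≥ : ∀ {n q} {G : CompleteMultipartite n q} → Orientation G → ℕ → Set
F≥ {n} D k = (S : Subset n) → IsForcingSet D S → k ≤ ∣ S ∣

F≤ : ∀ {n q} {G : CompleteMultipartite n q} → Orientation G → ℕ → Set
F≤ {n} D k = Σ (Subset n) λ S → IsForcingSet D S × ∣ S ∣ ≤ k

MOF≥ : ∀ {n q} → CompleteMultipartite n q → ℕ → Set
MOF≥ G k = Σ (Orientation G) λ D → F≥ D k

MOF≤ : ∀ {n q} → CompleteMultipartite n q → ℕ → Set
MOF≤ G k = (D : Orientation G) → F≤ D k

PartsAtLeastTwo : ∀ {n q} → CompleteMultipartite n q → Set
PartsAtLeastTwo {n} {q} G =
  (i : Fin q) → Σ (Fin n) λ u → Σ (Fin n) λ v → u ≢ v × part G u ≡ i × part G v ≡ i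

module Submission where

-- Number the parts 0,…,q-1 and orient every edge from the
-- lower-numbered part to the higher one (the "layered" orientation).  For
-- an arbitrary orientation, an uncoloured vertex without in-neighbours is
-- never forced, and neither is a pair of uncoloured vertices with equal
-- in-neighbourhoods (whoever forces one must first see the other coloured).
-- In the layered orientation part 0 has no in-arcs and two vertices of one
-- part have equal in-neighbourhoods, so the complement of a forcing set
-- meets only parts 1,…,q-1, each at most once: it has at most q-1 vertices.
--
-- An arc u → v makes all vertices but v a forcing set
-- (u forces v), whence F(D) ≤ n-1 = n-q+1 for q = 2.  A "split pair" — two
-- vertices s ≠ t of one part with an arc u → s and an arc t → w — makes all
-- vertices but w and s a forcing set (t forces w, then u forces s).  For
-- q = 3 with parts of size ≥ 2, a short case analysis on the arcs between
-- two vertices of each part and one vertex of each other part produces a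
-- split pair, since otherwise a triangle would have two sources or two sinks.

open import Defs
open import Data.Nat using (ℕ; _+_; _∸_; _≤_)
open import Data.Product using (_×_)
open import Data.Sum using (_⊎_)
open import Relation.Binary.PropositionalEquality using (_≡_)

open import Data.Nat using (zero; suc; z≤n; s≤s)
open import Data.Nat.Properties
  using (≤-trans; n≮0; +-comm; +-assoc; +-monoʳ-≤; +-cancelʳ-≤; m≤n+m∸n; m∸n+n≡m; m+n≤o⇒m≤o∸n; module ≤-Reasoning)
open import Data.Fin using (Fin; _<_; _<?_; _≟_; punchOut)
open import Data.Fin.Properties
  using (<⇒≢; <-cmp; <-asym; punchOut-injective; injective⇒≤; suc-injective)
open import Data.Fin.Subset using (Subset; ∣_∣; ∁; ⊤; _-_; _∈_; _∉_; inside; outside)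
open import Data.Fin.Subset.Properties
  using (x∈∁p⇒x∉p; ∣∁p∣≡n∸∣p∣; ∈⊤; ∣⊤∣≡n; x∈p∧x≢y⇒x∈p-y; x∈p⇒∣p-x∣<∣p∣)
open import Data.Vec.Base using (_∷_; []; here; there)
open import Data.Bool using (Bool; false; true)
open import Data.Empty using (⊥; ⊥-elim)
open import Data.Product using (_,_; proj₁; proj₂)
open import Data.Sum using (inj₁; inj₂)
open import Relation.Nullary using (¬_; yes; no; does)
open import Relation.Nullary.Decidable using (dec-true; dec-false; decidable-stable)
open import Relation.Binary using (tri<; tri≈; tri>)
open import Relation.Binary.PropositionalEquality using (refl; sym; trans; cong; subst; _≢_; ≢-sym)

∣p∣≤m-by-injection : ∀ {n m} (p : Subset n) (f : ∀ i → i ∈ p → Fin m) →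
  (∀ {i j} (i∈p : i ∈ p) (j∈p : j ∈ p) → f i i∈p ≡ f j j∈p → i ≡ j) → ∣ p ∣ ≤ m
∣p∣≤m-by-injection [] f inj = z≤n
∣p∣≤m-by-injection (outside ∷ p) f inj =
  ∣p∣≤m-by-injection p (λ i i∈p → f (Fin.suc i) (there i∈p))
    (λ i∈p j∈p eq → suc-injective (inj (there i∈p) (there j∈p) eq))
∣p∣≤m-by-injection {m = zero} (inside ∷ p) f inj with f Fin.zero here
... | ()
∣p∣≤m-by-injection {m = suc m} (inside ∷ p) f inj = s≤s (∣p∣≤m-by-injection p g g-injective)
  where
  -- the image of the head differs from the images of the tail, so the tail
  -- maps injectively into Fin m once that image is punched out
  head-apart : ∀ {i} (i∈p : i ∈ p) → f Fin.zero here ≢ f (Fin.suc i) (there i∈p)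
  head-apart i∈p eq with inj here (there i∈p) eq
  ... | ()
  g : ∀ i → i ∈ p → Fin m
  g i i∈p = punchOut (head-apart i∈p)
  g-injective : ∀ {i j} (i∈p : i ∈ p) (j∈p : j ∈ p) → g i i∈p ≡ g j j∈p → i ≡ j
  g-injective i∈p j∈p eq = suc-injective (inj (there i∈p) (there j∈p)
    (punchOut-injective (head-apart i∈p) (head-apart j∈p) eq))

-- Every part is nonempty, so there are at most as many parts as vertices.
parts≤order : ∀ {n q} (G : CompleteMultipartite n q) → q ≤ n
parts≤order G = injective⇒≤ {f = λ i → proj₁ (surjective G i)}
  (λ {i} {j} eq → trans (sym (proj₂ (surjective G i)))
                    (trans (cong (part G) eq) (proj₂ (surjective G j))))

-- Converting "at most p vertices are missing" into the bound n - (p+1) + 1.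
lower-arith : ∀ {n s p} → n ∸ s ≤ p → suc p ≤ n → n ∸ suc p + 1 ≤ s
lower-arith {n} {s} {p} missing p<n = +-cancelʳ-≤ p (n ∸ suc p + 1) s (begin
  n ∸ suc p + 1 + p   ≡⟨ +-assoc (n ∸ suc p) 1 p ⟩
  n ∸ suc p + suc p   ≡⟨ m∸n+n≡m p<n ⟩
  n                   ≤⟨ m≤n+m∸n n s ⟩
  s + (n ∸ s)         ≤⟨ +-monoʳ-≤ s missing ⟩
  s + p               ∎)
  where open ≤-Reasoning

∸-suc-bound : ∀ n r → n ∸ r ≤ suc (n ∸ suc r)
∸-suc-bound n       zero    = m≤n+m∸n n 1
∸-suc-bound zero    (suc r) = z≤n
∸-suc-bound (suc n) (suc r) = ∸-suc-bound n r

upper-arith : ∀ r {k n} → r + k ≤ n → k ≤ n ∸ suc r + 1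
upper-arith r {k} {n} r+k≤n = begin
  k                ≤⟨ m+n≤o⇒m≤o∸n k (subst (_≤ n) (+-comm r k) r+k≤n) ⟩
  n ∸ r            ≤⟨ ∸-suc-bound n r ⟩
  suc (n ∸ suc r)  ≡⟨ +-comm 1 (n ∸ suc r) ⟩
  n ∸ suc r + 1    ∎
  where open ≤-Reasoning

∈⊤-v : ∀ {n} {v z : Fin n} → z ≢ v → z ∈ ⊤ - v
∈⊤-v z≢v = x∈p∧x≢y⇒x∈p-y ∈⊤ z≢v

∈⊤-w-s : ∀ {n} {w s z : Fin n} → z ≢ w → z ≢ s → z ∈ ⊤ - w - s
∈⊤-w-s z≢w z≢s = x∈p∧x≢y⇒x∈p-y (∈⊤-v z≢w) z≢s

∣⊤-v∣ : ∀ {n} (v : Fin n) → 1 + ∣ ⊤ - v ∣ ≤ n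
∣⊤-v∣ {n} v = subst (1 + ∣ ⊤ - v ∣ ≤_) (∣⊤∣≡n n) (x∈p⇒∣p-x∣<∣p∣ {p = ⊤} (∈⊤ {x = v}))

∣⊤-w-s∣ : ∀ {n} (w s : Fin n) → s ≢ w → 2 + ∣ ⊤ - w - s ∣ ≤ n
∣⊤-w-s∣ w s s≢w = ≤-trans (s≤s (x∈p⇒∣p-x∣<∣p∣ (∈⊤-v s≢w))) (∣⊤-v∣ w)

module Forcing {n q} {G : CompleteMultipartite n q} (D : Orientation G) where

  out⇒≢ : ∀ {u v} → Out D u v → u ≢ v
  out⇒≢ {u} {v} u→v refl = arc-edge D u v u→v refl

  out-asym : ∀ {u v} → Out D u v → ¬ Out D v u
  out-asym {u} {v} u→v v→u with trans (sym (arc-asym D u v u→v)) v→u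
  ... | ()

  InNeighboursWithin : Fin n → Fin n → Set
  InNeighboursWithin x y = ∀ u → Out D u x → Out D u y

  source-uncolored : ∀ {S x} → x ∉ S → (∀ u → ¬ Out D u x) → ¬ Colored D S x
  source-uncolored x∉S no-in (initial x∈S)       = x∉S x∈S
  source-uncolored x∉S no-in (force {u} _ u→x _) = no-in u u→x

  -- Two distinct uncoloured vertices with the same in-neighbourhood are
  -- never forced: a vertex forcing one of them must see the other coloured.
  twins-uncolored : ∀ {S x y} → x ∉ S → y ∉ S → x ≢ y →
    InNeighboursWithin x y → InNeighboursWithin y x → ¬ Colored D S x
  twins-uncolored {S} {x} {y} x∉S y∉S x≢y x⊆y y⊆x colored = proj₁ (avoids colored) refl
    where
    avoids : ∀ {v} → Colored D S v → v ≢ x × v ≢ y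
    avoids (initial v∈S) = (λ { refl → x∉S v∈S }) , (λ { refl → y∉S v∈S })
    avoids (force {u} _ u→v others) = v≢x , v≢y
      where
      v≢x : _ ≢ x
      v≢x refl = proj₂ (avoids (others y (x⊆y u u→v) (≢-sym x≢y))) refl
      v≢y : _ ≢ y
      v≢y refl = proj₁ (avoids (others x (y⊆x u u→v) x≢y)) refl

  -- If u → v, every vertex but v forms a forcing set: u forces v.
  all-but-head : ∀ {u v} → Out D u v → IsForcingSet D (⊤ - v)
  all-but-head {u} {v} u→v z with z ≟ v
  ... | no z≢v    = initial (∈⊤-v z≢v)
  ... | yes refl  = force (initial (∈⊤-v (out⇒≢ u→v))) u→v (λ w _ w≢v → initial (∈⊤-v w≢v))

  arc⇒F≤ : ∀ {u v} → Out D u v → F≤ D (n ∸ 2 + 1)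
  arc⇒F≤ {v = v} u→v = ⊤ - v , all-but-head u→v , upper-arith 1 (∣⊤-v∣ v)

  record SplitPair : Set where
    field
      s t u w   : Fin n
      s≢t       : s ≢ t
      same-part : part G s ≡ part G t
      u→s       : Out D u s
      t→w       : Out D t w

  -- All vertices but w and s form a forcing set: t forces w (s, lying in
  -- the part of t, is no out-neighbour of t), then u forces s.
  splitPair⇒F≤ : SplitPair → F≤ D (n ∸ 3 + 1)
  splitPair⇒F≤ sp = ⊤ - w - s , forcing , upper-arith 2 (∣⊤-w-s∣ w s s≢w)
    where
    open SplitPair sp
    S : Subset n
    S = ⊤ - w - s
    not-out-of-t : ∀ {z} → Out D t z → z ≢ s
    not-out-of-t {z} t→z refl = arc-edge D t s t→z (sym same-part)
    s≢w : s ≢ w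
    s≢w = ≢-sym (not-out-of-t t→w)
    all-but-s : ∀ z → z ≢ s → Colored D S z
    all-but-s z z≢s with z ≟ w
    ... | no z≢w   = initial (∈⊤-w-s z≢w z≢s)
    ... | yes refl = force (initial (∈⊤-w-s (out⇒≢ t→w) (≢-sym s≢t))) t→w
                       (λ z' t→z' z'≢w → initial (∈⊤-w-s z'≢w (not-out-of-t t→z')))
    forcing : IsForcingSet D S
    forcing z with z ≟ s
    ... | no z≢s   = all-but-s z z≢s
    ... | yes refl = force (all-but-s u (out⇒≢ u→s)) u→s (λ z' _ z'≢s → all-but-s z' z'≢s)

  data Extreme (x y z : Fin n) : Set where
    beats-both     : Out D x y → Out D x z → Extreme x y z
    beaten-by-both : Out D y x → Out D z x → Extreme x y z

  -- In a triangle at most one vertex beats both others and at most one is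
  -- beaten by both, so the three vertices cannot all be extreme.
  triangle-not-extreme : ∀ {a b c} → Extreme a b c → Extreme b a c → Extreme c a b → ⊥
  triangle-not-extreme (beats-both a→b _)     (beats-both b→a _)     _ = out-asym a→b b→a
  triangle-not-extreme (beaten-by-both b→a _) (beaten-by-both a→b _) _ = out-asym a→b b→a
  triangle-not-extreme (beats-both _ a→c)     (beaten-by-both _ c→b) (beats-both c→a _)     = out-asym a→c c→a
  triangle-not-extreme (beats-both _ _)       (beaten-by-both _ c→b) (beaten-by-both _ b→c) = out-asym b→c c→b
  triangle-not-extreme (beaten-by-both _ _)   (beats-both _ b→c)     (beats-both _ c→b)     = out-asym b→c c→b
  triangle-not-extreme (beaten-by-both _ c→a) (beats-both _ _)       (beaten-by-both a→c _) = out-asym a→c c→a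

  pair-vs-vertex : ∀ {s t x} → s ≢ t → part G s ≡ part G t → part G x ≢ part G s →
    SplitPair ⊎ Extreme x s t
  pair-vs-vertex {s} {t} {x} s≢t same x≁s
    with arc-total D s x (≢-sym x≁s) | arc-total D t x (λ eq → x≁s (sym (trans same eq)))
  ... | inj₁ s→x | inj₁ t→x = inj₂ (beaten-by-both s→x t→x)
  ... | inj₂ x→s | inj₂ x→t = inj₂ (beats-both x→s x→t)
  ... | inj₂ x→s | inj₁ t→x = inj₁ (record
        { s = s ; t = t ; u = x ; w = x ; s≢t = s≢t ; same-part = same ; u→s = x→s ; t→w = t→x })
  ... | inj₁ s→x | inj₂ x→t = inj₁ (record
        { s = t ; t = s ; u = x ; w = x ; s≢t = ≢-sym s≢t ; same-part = sym same ; u→s = x→t ; t→w = s→x })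

  pair-vs-two : ∀ {s t x y} → s ≢ t → part G s ≡ part G t →
    part G x ≢ part G s → part G y ≢ part G s → SplitPair ⊎ Extreme s x y
  pair-vs-two {s} {t} {x} {y} s≢t same x≁s y≁s
    with pair-vs-vertex s≢t same x≁s | pair-vs-vertex s≢t same y≁s
  ... | inj₁ sp | _      = inj₁ sp
  ... | inj₂ _  | inj₁ sp = inj₁ sp
  ... | inj₂ (beats-both x→s _)     | inj₂ (beats-both y→s _)     = inj₂ (beaten-by-both x→s y→s)
  ... | inj₂ (beaten-by-both s→x _) | inj₂ (beaten-by-both s→y _) = inj₂ (beats-both s→x s→y)
  ... | inj₂ (beats-both x→s _)     | inj₂ (beaten-by-both _ t→y) = inj₁ (record
        { s = s ; t = t ; u = x ; w = y ; s≢t = s≢t ; same-part = same ; u→s = x→s ; t→w = t→y })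
  ... | inj₂ (beaten-by-both _ t→x) | inj₂ (beats-both y→s _)     = inj₁ (record
        { s = s ; t = t ; u = y ; w = x ; s≢t = s≢t ; same-part = same ; u→s = y→s ; t→w = t→x })

  three-parts⇒splitPair : ∀ {a a' b b' c c'} →
    a ≢ a' → part G a ≡ part G a' → b ≢ b' → part G b ≡ part G b' →
    c ≢ c' → part G c ≡ part G c' →
    part G a ≢ part G b → part G a ≢ part G c → part G b ≢ part G c → SplitPair
  three-parts⇒splitPair a≢a' a≈a' b≢b' b≈b' c≢c' c≈c' a≁b a≁c b≁c
    with pair-vs-two a≢a' a≈a' (≢-sym a≁b) (≢-sym a≁c)
       | pair-vs-two b≢b' b≈b' a≁b (≢-sym b≁c)
       | pair-vs-two c≢c' c≈c' a≁c b≁c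
  ... | inj₁ sp | _       | _       = sp
  ... | inj₂ _  | inj₁ sp | _       = sp
  ... | inj₂ _  | inj₂ _  | inj₁ sp = sp
  ... | inj₂ ea | inj₂ eb | inj₂ ec = ⊥-elim (triangle-not-extreme ea eb ec)

module Layered {n q} (G : CompleteMultipartite n q) where

  precedes : Fin n → Fin n → Bool
  precedes u v = does (part G u <? part G v)

  precedes⇒< : ∀ {u v} → precedes u v ≡ true → part G u < part G v
  precedes⇒< {u} {v} u→v = decidable-stable (part G u <? part G v) λ u≮v →
    false≢true (trans (sym (dec-false (part G u <? part G v) u≮v)) u→v)
    where
    false≢true : false ≢ true
    false≢true ()

  <⇒precedes : ∀ {u v} → part G u < part G v → precedes u v ≡ true
  <⇒precedes {u} {v} = dec-true (part G u <? part G v)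

  layered : Orientation G
  layered = record
    { arc       = precedes
    ; arc-edge  = λ u v u→v → <⇒≢ (precedes⇒< u→v)
    ; arc-total = total
    ; arc-asym  = asym
    }
    where
    total : ∀ u v → part G u ≢ part G v → precedes u v ≡ true ⊎ precedes v u ≡ true
    total u v u≁v with <-cmp (part G u) (part G v)
    ... | tri< u<v _ _ = inj₁ (<⇒precedes u<v)
    ... | tri≈ _ eq _  = ⊥-elim (u≁v eq)
    ... | tri> _ _ v<u = inj₂ (<⇒precedes v<u)
    asym : ∀ u v → precedes u v ≡ true → precedes v u ≡ false
    asym u v u→v = dec-false (part G v <? part G u) (<-asym (precedes⇒< u→v))

  same-part-twins : ∀ {x y} → part G x ≡ part G y → Forcing.InNeighboursWithin layered x y
  same-part-twins x≈y u u→x = <⇒precedes (subst (part G u <_) x≈y (precedes⇒< u→x))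

lower-bound : ∀ {n p} (G : CompleteMultipartite n (suc p)) → MOF≥ G (n ∸ suc p + 1)
lower-bound {n} {p} G = layered , bound
  where
  open Layered G
  open Forcing layered
  bound : F≥ layered (n ∸ suc p + 1)
  bound S forcing = lower-arith (subst (_≤ p) (∣∁p∣≡n∸∣p∣ S) ∣∁S∣≤p) (parts≤order G)
    where
    -- no uncoloured vertex lies in the first part, which has no in-arcs
    first-part-colored : ∀ {v} → v ∈ ∁ S → Fin.zero ≢ part G v
    first-part-colored {v} v∈∁S v₀ =
      source-uncolored (x∈∁p⇒x∉p v∈∁S)
        (λ u u→v → n≮0 (subst (part G u <_) (sym v₀) (precedes⇒< u→v)))
        (forcing v)
    one-per-part : ∀ {u v} → u ∈ ∁ S → v ∈ ∁ S → part G u ≡ part G v → u ≡ v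
    one-per-part {u} {v} u∈∁S v∈∁S same with u ≟ v
    ... | yes u≡v = u≡v
    ... | no u≢v  = ⊥-elim (twins-uncolored (x∈∁p⇒x∉p u∈∁S) (x∈∁p⇒x∉p v∈∁S) u≢v
                      (same-part-twins same) (same-part-twins (sym same)) (forcing u))
    ∣∁S∣≤p : ∣ ∁ S ∣ ≤ p
    ∣∁S∣≤p = ∣p∣≤m-by-injection (∁ S) (λ v v∈∁S → punchOut (first-part-colored v∈∁S))
      (λ u∈∁S v∈∁S eq → one-per-part u∈∁S v∈∁S
        (punchOut-injective (first-part-colored u∈∁S) (first-part-colored v∈∁S) eq))

parts-differ : ∀ {n q} (G : CompleteMultipartite n q) {x y} {i j : Fin q} →
  part G x ≡ i → part G y ≡ j → i ≢ j → part G x ≢ part G y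
parts-differ G x∈i y∈j i≢j eq = i≢j (trans (sym x∈i) (trans eq y∈j))

-- For q = 2 every orientation has an arc.
upper-bipartite : ∀ {n} (G : CompleteMultipartite n 2) → MOF≤ G (n ∸ 2 + 1)
upper-bipartite G D with surjective G Fin.zero | surjective G (Fin.suc Fin.zero)
... | x , x∈0 | y , y∈1 with arc-total D x y (parts-differ G x∈0 y∈1 (λ ()))
... | inj₁ x→y = Forcing.arc⇒F≤ D x→y
... | inj₂ y→x = Forcing.arc⇒F≤ D y→x

-- For q = 3 with parts of size ≥ 2 every orientation has a split pair.
upper-tripartite : ∀ {n} (G : CompleteMultipartite n 3) → PartsAtLeastTwo G → MOF≤ G (n ∸ 3 + 1)
upper-tripartite G two D
  with two Fin.zero | two (Fin.suc Fin.zero) | two (Fin.suc (Fin.suc Fin.zero))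
... | a , a' , a≢a' , a∈0 , a'∈0 | b , b' , b≢b' , b∈1 , b'∈1 | c , c' , c≢c' , c∈2 , c'∈2 =
  splitPair⇒F≤ (three-parts⇒splitPair
    a≢a' (trans a∈0 (sym a'∈0)) b≢b' (trans b∈1 (sym b'∈1)) c≢c' (trans c∈2 (sym c'∈2))
    (parts-differ G a∈0 b∈1 (λ ())) (parts-differ G a∈0 c∈2 (λ ())) (parts-differ G b∈1 c∈2 (λ ())))
  where open Forcing D

corollary14 : (n q : ℕ) → 2 ≤ q → (G : CompleteMultipartite n q) →
    MOF≥ G (n ∸ q + 1)
    × (q ≡ 2 ⊎ (q ≡ 3 × PartsAtLeastTwo G) → MOF≤ G (n ∸ q + 1))
corollary14 n .(suc (suc r)) (s≤s (s≤s {n = r} z≤n)) G = lower-bound G , upper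
  where
  upper : suc (suc r) ≡ 2 ⊎ (suc (suc r) ≡ 3 × PartsAtLeastTwo G) → MOF≤ G (n ∸ suc (suc r) + 1)
  upper (inj₁ refl)         = upper-bipartite G
  upper (inj₂ (refl , two)) = upper-tripartite G two
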